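{- Let $k\ge3$ be odd and let $H$ be a Kimura Hadamard matrix of order $8k+4$ yielded by $a,b,c,d\in\mathbb{Z}D_{2k}$ that are all $y$-invariant. Let $P=\mathrm{bdiag}(I_k,I_k)$ and $Q=\mathrm{diag}(I_4,P,P,P,P)$. Then $(Q,Q)$ is an automorphism of $H$ of order $2$ (it swaps, within each $2k\times 2k$ block, the top and bottom halves as well as the left and right halves).
   Context: Let $k\geq 3$ be odd. $D_{2k}=\langle x,y\mid x^k=1,\ y^2=1,\ y^{ -1}xy=x^{ -1}\rangle$, with elements listed in the order $x^0,\dots,x^{k-1},y,xy,\dots,x^{k-1}y$, which indexes rows and columns of $2k\times2k$ matrices. $\rho(g)=[\delta_{ug,v}]_{u,v}$ is the right regular matrix representation, extended linearly to $\mathbb{Z}D_{2k}$; for $w\in\mathbb{Z}D_{2k}$ with coefficients in $\{0,1\}$ its associated $\pm1$-matrix is $2\rho(w)-J_{2k}$. We say $a,b,c,d\in\mathbb{Z}D_{2k}$ (coefficients in $\{0,1\}$, associated $\pm1$-matrices $A,B,C,D$) yield the Kimura Hadamard matrix \[ H=\begin{bmatrix} 1& 1 & 1 & 1 & \mathbf{1} & \mathbf{1} & \mathbf{1} & \mathbf{1}\\ 1& 1 & -1 & -1 & \mathbf{1} & \mathbf{1} & -\mathbf{1} & -\mathbf{1}\\ 1& -1 & 1 & -1 & \mathbf{1} & -\mathbf{1} & \mathbf{1} & -\mathbf{1}\\ 1& -1 & -1 & 1 & -\mathbf{1} & \mathbf{1} & \mathbf{1} & -\mathbf{1}\\ \mathbf{1}^\intercal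 & \mathbf{1}^\intercal & \mathbf{1}^\intercal & -\mathbf{1}^\intercal & A & B& C & D\\ \mathbf{1}^\intercal & \mathbf{1}^\intercal& -\mathbf{1}^\intercal & \mathbf{1}^\intercal & -B & A & D & -C\\ \mathbf{1}^\intercal & -\mathbf{1}^\intercal& \mathbf{1}^\intercal & \mathbf{1}^\intercal & -C & -D & A & B\\ \mathbf{1}^\intercal & -\mathbf{1}^\intercal& -\mathbf{1}^\intercal & -\mathbf{1}^\intercal & D & -C & B & -A \end{bmatrix} \] ($\mathbf 1$ the all-ones row vector of length $2k$) if $HH^\intercal=(8k+4)I_{8k+4}$. An element $w=w_1+w_2y$ with $w_1,w_2\in\mathbb{Z}\langle x\rangle$ is $y$-invariant if $y^{ -1}w_iy=w_i$ for $i=1,2$. $\mathrm{Aut}(H)=\{(R,S): R,S\ \text{are}\ (8k+4)\times(8k+4)\ \text{signed permutation matrices},\ RHS^\intercal=H\}$. $\mathrm{diag}$ denotes block diagonal and $\mathrm{bdiag}(Y_1,\dots,Y_n)$ block anti-diagonal with $Y_1$ top right to $Y_n$ bottom left. -}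

module Defs where

open import Data.Nat as ℕ using (ℕ; zero; suc; NonZero; _∸_)
open import Data.Nat.DivMod using (_mod_)
open import Data.Fin as Fin using (Fin; zero; suc; toℕ; remQuot; combine; splitAt; _≟_)
open import Data.Integer as ℤ using (ℤ; +_; -_; _+_; _-_; _*_)
open import Data.Bool using (Bool; true; false; if_then_else_; _∧_)
open import Data.Product using (_×_; _,_; ∃; Σ)
open import Data.Sum using (_⊎_; inj₁; inj₂)
open import Relation.Nullary using (¬_)
open import Relation.Nullary.Decidable using (⌊_⌋)
open import Relation.Binary.PropositionalEquality using (_≡_; _≢_)

∑ : ∀ {n} → (Fin n → ℤ) → ℤ
∑ {zero}  f = + 0
∑ {suc n} f = f zero + ∑ (λ i → f (suc i))

Mat : ℕ → Set
Mat n = Fin n → Fin n → ℤ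

infixl 7 _⊗_
infix 8 _ᵀ
infix 4 _≐_
_⊗_ : ∀ {n} → Mat n → Mat n → Mat n
(M ⊗ N) i j = ∑ (λ l → M i l * N l j)

_ᵀ : ∀ {n} → Mat n → Mat n
(M ᵀ) i j = M j i

δ : ∀ {n} → Fin n → Fin n → ℤ
δ i j = if ⌊ i ≟ j ⌋ then + 1 else + 0

Id : ∀ {n} → Mat n
Id = δ

J : ∀ {n} → Mat n
J _ _ = + 1

_≐_ : ∀ {n} → Mat n → Mat n → Set
M ≐ N = ∀ i j → M i j ≡ N i j

IsSignedPerm : ∀ {n} → Mat n → Set
IsSignedPerm {n} M =
  (∀ i → ∃ λ j → (M i j ≡ + 1 ⊎ M i j ≡ - (+ 1)) × (∀ j' → j' ≢ j → M i j' ≡ + 0)) ×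
  (∀ j → ∃ λ i → (M i j ≡ + 1 ⊎ M i j ≡ - (+ 1)) × (∀ i' → i' ≢ i → M i' j ≡ + 0))

-- The dihedral group D_{2k}.  Elements are Fin (2 * k); the element
-- x^i y^e (e ∈ {0,1}, 0 ≤ i < k) has index e * k + i, i.e. the order
-- x^0, …, x^{k-1}, y, xy, …, x^{k-1} y.

module Dihedral (k : ℕ) .{{_ : NonZero k}} where

  D : Set
  D = Fin (2 ℕ.* k)

  elt : Fin k → Fin 2 → D
  elt i e = combine e i

  yexp : D → Fin 2
  yexp g = Data.Product.proj₁ (remQuot {2} k g)

  xexp : D → Fin k
  xexp g = Data.Product.proj₂ (remQuot {2} k g)

  add2 : Fin 2 → Fin 2 → Fin 2
  add2 zero f = f
  add2 (suc zero) zero = suc zero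
  add2 (suc zero) (suc zero) = zero

  -- (x^i y^e)(x^j y^f) = x^{i + (-1)^e j} y^{e+f}, using y x^j = x^{-j} y
  _·_ : D → D → D
  g · h with remQuot {2} k g | remQuot {2} k h
  ... | (zero , i) | (f , j) = elt ((toℕ i ℕ.+ toℕ j) mod k) f
  ... | (suc e , i) | (f , j) = elt ((toℕ i ℕ.+ (k ∸ toℕ j)) mod k) (add2 (suc e) f)

  x : D
  x = elt (1 mod k) zero

  y : D
  y = elt (0 mod k) (suc zero)

  ZD : Set
  ZD = D → ℤ

  ZeroOne : ZD → Set
  ZeroOne w = ∀ g → w g ≡ + 0 ⊎ w g ≡ + 1

  -- conjugation y⁻¹ w y = Σ_h w_h (y h y); coefficient at g is w_{y g y}
  -- (since y⁻¹ = y)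
  conjY : ZD → ZD
  conjY w g = w ((y · g) · y)

  -- w = w₁ + w₂ y with w₁, w₂ ∈ ℤ⟨x⟩
  part₁ : ZD → ZD
  part₁ w g with remQuot {2} k g
  ... | (zero , i)  = w (elt i zero)
  ... | (suc _ , _) = + 0

  part₂ : ZD → ZD
  part₂ w g with remQuot {2} k g
  ... | (zero , i)  = w (elt i (suc zero))
  ... | (suc _ , _) = + 0

  yInvariant : ZD → Set
  yInvariant w = (∀ g → conjY (part₁ w) g ≡ part₁ w g) × (∀ g → conjY (part₂ w) g ≡ part₂ w g)

  ρ : D → Mat (2 ℕ.* k)
  ρ g u v = δ (u · g) v

  ρZ : ZD → Mat (2 ℕ.* k)
  ρZ w u v = ∑ (λ g → w g * ρ g u v)

  pm : ZD → Mat (2 ℕ.* k)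
  pm w u v = + 2 * ρZ w u v - J u v

  -- An index is either one of the 4 leading indices, or a pair
  -- (block r ∈ Fin 4, position u ∈ Fin (2k)) with index 4 + r * 2k + u.

  N : ℕ
  N = 4 ℕ.+ 4 ℕ.* (2 ℕ.* k)

  ± : Bool → ℤ
  ± true  = + 1
  ± false = - (+ 1)

  S : Fin 4 → Fin 4 → ℤ
  S zero _ = + 1
  S (suc zero) j = ± (⌊ j ≟ zero ⌋ Data.Bool.∨ ⌊ j ≟ suc zero ⌋)
  S (suc (suc zero)) j = ± (⌊ j ≟ zero ⌋ Data.Bool.∨ ⌊ j ≟ suc (suc zero) ⌋)
  S (suc (suc (suc zero))) j = ± (⌊ j ≟ zero ⌋ Data.Bool.∨ ⌊ j ≟ suc (suc (suc zero)) ⌋)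

  -- sign of the block ±𝟏 in row i (i < 4) and block column r
  Top : Fin 4 → Fin 4 → ℤ
  Top zero _ = + 1
  Top (suc zero) r = ± (⌊ r ≟ zero ⌋ Data.Bool.∨ ⌊ r ≟ suc zero ⌋)
  Top (suc (suc zero)) r = ± (⌊ r ≟ zero ⌋ Data.Bool.∨ ⌊ r ≟ suc (suc zero) ⌋)
  Top (suc (suc (suc zero))) r = ± (⌊ r ≟ suc zero ⌋ Data.Bool.∨ ⌊ r ≟ suc (suc zero) ⌋)

  -- sign of the block ±𝟏ᵀ in block row r and column j (j < 4)
  Left : Fin 4 → Fin 4 → ℤ
  Left zero j = ± (Data.Bool.not ⌊ j ≟ suc (suc (suc zero)) ⌋)
  Left (suc zero) j = ± (Data.Bool.not ⌊ j ≟ suc (suc zero) ⌋)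
  Left (suc (suc zero)) j = ± (Data.Bool.not ⌊ j ≟ suc zero ⌋)
  Left (suc (suc (suc zero))) j = ± ⌊ j ≟ zero ⌋

  Core : (A B C D' : Mat (2 ℕ.* k)) → Fin 4 → Fin 4 → Mat (2 ℕ.* k)
  Core A B C D' zero zero = A
  Core A B C D' zero (suc zero) = B
  Core A B C D' zero (suc (suc zero)) = C
  Core A B C D' zero (suc (suc (suc zero))) = D'
  Core A B C D' (suc zero) zero u v = - B u v
  Core A B C D' (suc zero) (suc zero) = A
  Core A B C D' (suc zero) (suc (suc zero)) = D'
  Core A B C D' (suc zero) (suc (suc (suc zero))) u v = - C u v
  Core A B C D' (suc (suc zero)) zero u v = - C u v
  Core A B C D' (suc (suc zero)) (suc zero) u v = - D' u v
  Core A B C D' (suc (suc zero)) (suc (suc zero)) = A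
  Core A B C D' (suc (suc zero)) (suc (suc (suc zero))) = B
  Core A B C D' (suc (suc (suc zero))) zero = D'
  Core A B C D' (suc (suc (suc zero))) (suc zero) u v = - C u v
  Core A B C D' (suc (suc (suc zero))) (suc (suc zero)) = B
  Core A B C D' (suc (suc (suc zero))) (suc (suc (suc zero))) u v = - A u v

  Kimura : (a b c d : ZD) → Mat N
  Kimura a b c d i j with splitAt 4 i | splitAt 4 j
  ... | inj₁ i' | inj₁ j' = S i' j'
  ... | inj₁ i' | inj₂ j' = Top i' (Data.Product.proj₁ (remQuot {4} (2 ℕ.* k) j'))
  ... | inj₂ i' | inj₁ j' = Left (Data.Product.proj₁ (remQuot {4} (2 ℕ.* k) i')) j'
  ... | inj₂ i' | inj₂ j' with remQuot {4} (2 ℕ.* k) i' | remQuot {4} (2 ℕ.* k) j'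
  ...   | (r , u) | (s , v) = Core (pm a) (pm b) (pm c) (pm d) r s u v

  YieldsKimuraHadamard : (a b c d : ZD) → Set
  YieldsKimuraHadamard a b c d =
    (Kimura a b c d ⊗ (Kimura a b c d) ᵀ) ≐ (λ i j → + N * Id i j)

  IsAut : Mat N → Mat N → Mat N → Set
  IsAut H R S' = IsSignedPerm R × IsSignedPerm S' × ((R ⊗ H) ⊗ (S' ᵀ)) ≐ H

  HasOrder2 : Mat N → Mat N → Set
  HasOrder2 R S' = ((R ⊗ R) ≐ Id × (S' ⊗ S') ≐ Id) × ¬ (R ≐ Id × S' ≐ Id)

  -- bdiag(Y₁, Y₂) for 2 × 2 blocks of size k (Y₁ top right)
  bdiag : (Y₁ Y₂ : Fin k → Fin k → ℤ) → Mat (2 ℕ.* k)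
  bdiag Y₁ Y₂ u v with remQuot {2} k u | remQuot {2} k v
  ... | (zero , i) | (suc zero , j) = Y₁ i j
  ... | (suc zero , i) | (zero , j) = Y₂ i j
  ... | _ | _ = + 0

  P : Mat (2 ℕ.* k)
  P = bdiag Id Id

  Q : Mat N
  Q i j with splitAt 4 i | splitAt 4 j
  ... | inj₁ i' | inj₁ j' = Id i' j'
  ... | inj₂ i' | inj₂ j' with remQuot {4} (2 ℕ.* k) i' | remQuot {4} (2 ℕ.* k) j'
  ...   | (r , u) | (s , v) = if ⌊ r ≟ s ⌋ then P u v else + 0
  Q i j | _ | _ = + 0

-- Q is the permutation matrix of the involution of the index set that fixes the first four
-- indices and right-multiplies by y inside each 2k-block; indeed P = ρ(y). So Q H Qᵀ is H with
-- rows and columns permuted by this involution, and the ±1-border of H is visibly unchanged.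
-- On the blocks, ρ(y) ρ(w) ρ(y) = ρ(y w y) = ρ(w) for y-invariant w, because y-invariance of
-- w = w₁ + w₂ y amounts to w being fixed by conjugation by y; hence A, B, C, D are fixed.
-- Finally g y ≠ g for all g, so Q ≠ I.
module Submission where

open import Defs
open import Algebra.Definitions using (Involutive)
open import Data.Fin using (Fin; zero; suc; toℕ; _↑ˡ_; _↑ʳ_; combine; remQuot; splitAt; _≟_)
open import Data.Fin.Permutation using (permutation)
open import Data.Fin.Properties
  using (toℕ-injective; toℕ-fromℕ<; toℕ<n; suc-injective; ↑ˡ-injective; ↑ʳ-injective;
         splitAt-↑ˡ; splitAt⁻¹-↑ˡ; splitAt⁻¹-↑ʳ;
         remQuot-combine; combine-remQuot; combine-injectiveˡ; combine-injectiveʳ)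
open import Data.Integer as ℤ using (ℤ; +_; -_)
import Data.Integer.Properties as ℤ
open import Algebra.Properties.CommutativeMonoid.Sum ℤ.+-0-commutativeMonoid using (sum; sum-permute)
open import Data.Nat as ℕ using (ℕ; NonZero; zero; suc; _≤_; _<_; _∸_; _%_; _+_; _*_)
import Data.Nat.Properties as ℕ
open import Data.Nat.DivMod using (_mod_; m%n<n; m<n⇒m%n≡m; [m+n]%n≡m%n; %-distribˡ-+; m%n%n≡m%n; n%n≡0)
open import Data.Product using (∃; _×_; _,_; proj₁; proj₂; uncurry)
open import Data.Sum using (inj₁; inj₂)
open import Data.Bool using (if_then_else_)
open import Function using (_∘_)
open import Function.Definitions using (Injective)
open import Relation.Nullary using (¬_; yes; no; contradiction)
open import Relation.Nullary.Decidable using (⌊_⌋)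
open import Relation.Binary.PropositionalEquality

δ-refl : ∀ {n} (i : Fin n) → δ i i ≡ + 1
δ-refl i with i ≟ i
... | yes _   = refl
... | no i≢i = contradiction refl i≢i

δ-≢ : ∀ {n} {i j : Fin n} → i ≢ j → δ i j ≡ + 0
δ-≢ {i = i} {j} i≢j with i ≟ j
... | yes i≡j = contradiction i≡j i≢j
... | no _    = refl

δ-injective : ∀ {m n} {f : Fin m → Fin n} → Injective _≡_ _≡_ f → ∀ i j → δ (f i) (f j) ≡ δ i j
δ-injective {f = f} f-inj i j with i ≟ j
... | yes refl = δ-refl (f i)
... | no i≢j   = δ-≢ (i≢j ∘ f-inj)

δ-combine : ∀ {m n} (r s : Fin m) (u v : Fin n) →
            δ (combine r u) (combine s v) ≡ (if ⌊ r ≟ s ⌋ then δ u v else + 0)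
δ-combine r s u v with r ≟ s
... | yes refl = δ-injective (λ {u} {v} → combine-injectiveʳ r u r v) u v
... | no r≢s   = δ-≢ (r≢s ∘ combine-injectiveˡ r u s v)

∑-cong : ∀ {n} {f g : Fin n → ℤ} → (∀ i → f i ≡ g i) → ∑ f ≡ ∑ g
∑-cong {zero}  f≗g = refl
∑-cong {suc n} f≗g = cong₂ ℤ._+_ (f≗g zero) (∑-cong (f≗g ∘ suc))

∑-zero : ∀ n → ∑ {n} (λ _ → + 0) ≡ + 0
∑-zero zero    = refl
∑-zero (suc n) = trans (ℤ.+-identityˡ _) (∑-zero n)

∑-δˡ : ∀ {n} (i : Fin n) (f : Fin n → ℤ) → ∑ (λ l → δ i l ℤ.* f l) ≡ f i
∑-δˡ {suc n} zero f = begin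
  + 1 ℤ.* f zero ℤ.+ ∑ {n} (λ _ → + 0) ≡⟨ cong₂ ℤ._+_ (ℤ.*-identityˡ (f zero)) (∑-zero n) ⟩
  f zero ℤ.+ + 0                       ≡⟨ ℤ.+-identityʳ (f zero) ⟩
  f zero                               ∎
  where open ≡-Reasoning
∑-δˡ {suc n} (suc i) f = begin
  + 0 ℤ.+ ∑ (λ l → δ (suc i) (suc l) ℤ.* f (suc l)) ≡⟨ ℤ.+-identityˡ _ ⟩
  ∑ (λ l → δ (suc i) (suc l) ℤ.* f (suc l))         ≡⟨ ∑-cong (λ l → cong (ℤ._* f (suc l)) (δ-injective suc-injective i l)) ⟩
  ∑ (λ l → δ i l ℤ.* f (suc l))                     ≡⟨ ∑-δˡ i (f ∘ suc) ⟩
  f (suc i)                                         ∎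
  where open ≡-Reasoning

∑-δʳ : ∀ {n} (i : Fin n) (f : Fin n → ℤ) → ∑ (λ l → f l ℤ.* δ i l) ≡ f i
∑-δʳ i f = trans (∑-cong (λ l → ℤ.*-comm (f l) (δ i l))) (∑-δˡ i f)

sum≡∑ : ∀ {n} (f : Fin n → ℤ) → sum f ≡ ∑ f
sum≡∑ {zero}  f = refl
sum≡∑ {suc n} f = cong (λ s → f zero ℤ.+ s) (sum≡∑ (f ∘ suc))

∑-reindex-involution : ∀ {n} {π : Fin n → Fin n} → Involutive _≡_ π → (f : Fin n → ℤ) → ∑ f ≡ ∑ (f ∘ π)
∑-reindex-involution {n} {π} π-inv f = begin
  ∑ f         ≡⟨ sum≡∑ f ⟨
  sum f       ≡⟨ sum-permute {n} {n} f (permutation π π π-inv π-inv) ⟩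
  sum (f ∘ π) ≡⟨ sum≡∑ (f ∘ π) ⟩
  ∑ (f ∘ π)   ∎
  where open ≡-Reasoning

permMat : ∀ {n} → (Fin n → Fin n) → Mat n
permMat π i j = δ (π i) j

Invariant : ∀ {n} → (Fin n → Fin n) → Mat n → Set
Invariant π M = ∀ i j → M (π i) (π j) ≡ M i j

module _ {n} {π : Fin n → Fin n} {R : Mat n} (R≐π : R ≐ permMat π) where

  permMat-⊗ : (M : Mat n) → (R ⊗ M) ≐ (λ i j → M (π i) j)
  permMat-⊗ M i j = trans (∑-cong (λ l → cong (ℤ._* M l j) (R≐π i l))) (∑-δˡ (π i) (λ l → M l j))

  ⊗-permMatᵀ : (M : Mat n) → (M ⊗ R ᵀ) ≐ (λ i j → M i (π j))
  ⊗-permMatᵀ M i j = trans (∑-cong (λ l → cong (M i l ℤ.*_) (R≐π j l))) (∑-δʳ (π j) (M i))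

  permMat-conjugate : ∀ {M} → Invariant π M → ((R ⊗ M) ⊗ R ᵀ) ≐ M
  permMat-conjugate {M} M-inv i j = begin
    ((R ⊗ M) ⊗ R ᵀ) i j ≡⟨ ⊗-permMatᵀ (R ⊗ M) i j ⟩
    (R ⊗ M) i (π j)     ≡⟨ permMat-⊗ M i (π j) ⟩
    M (π i) (π j)       ≡⟨ M-inv i j ⟩
    M i j               ∎
    where open ≡-Reasoning

  module _ (π-inv : Involutive _≡_ π) where

    permMat-involutive : (R ⊗ R) ≐ Id
    permMat-involutive i j = trans (permMat-⊗ R i j) (trans (R≐π (π i) j) (cong (λ l → δ l j) (π-inv i)))

    permMat-isSignedPerm : IsSignedPerm R
    permMat-isSignedPerm =
        (λ i → π i , inj₁ (trans (R≐π i (π i)) (δ-refl (π i)))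
                   , λ j j≢πi → trans (R≐π i j) (δ-≢ (j≢πi ∘ sym)))
      , (λ j → π j , inj₁ (trans (R≐π (π j) j) (trans (cong (λ l → δ l j) (π-inv j)) (δ-refl j)))
                   , λ i i≢πj → trans (R≐π i j) (δ-≢ (λ πi≡j → i≢πj (trans (sym (π-inv i)) (cong π πi≡j)))))

  permMat-≢Id : ∀ i → π i ≢ i → ¬ (R ≐ Id)
  permMat-≢Id i πi≢i R≐Id with trans (sym (trans (R≐π i i) (δ-≢ πi≢i))) (trans (R≐Id i i) (δ-refl i))
  ... | ()

combine-elim : ∀ {m n} (P : Fin (m * n) → Set) → (∀ i j → P (combine i j)) → ∀ g → P g
combine-elim {m} {n} P P-combine g =
  subst P (combine-remQuot {m} n g) (P-combine (proj₁ (remQuot {m} n g)) (proj₂ (remQuot {m} n g)))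

blocks-elim : ∀ {m n l} (P : Fin (m + n * l) → Set) →
              (∀ a → P (a ↑ˡ n * l)) → (∀ r u → P (m ↑ʳ combine r u)) → ∀ i → P i
blocks-elim {m} {n} {l} P P-top P-block i with splitAt m i in eq
... | inj₁ a = subst P (splitAt⁻¹-↑ˡ eq) (P-top a)
... | inj₂ b = subst P (splitAt⁻¹-↑ʳ eq) (combine-elim {n} {l} (P ∘ (m ↑ʳ_)) P-block b)

module _ (k : ℕ) .{{_ : NonZero k}} where
  open Dihedral k

  -- The exponent arithmetic of x exactly as written in Dihedral._·_, so that x-· and xy-·
  -- below hold by computation.
  infixl 6 _+ₖ_ _-ₖ_
  infix 8 -ₖ_

  _+ₖ_ _-ₖ_ : Fin k → Fin k → Fin k
  i +ₖ j = (toℕ i + toℕ j) mod k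
  i -ₖ j = (toℕ i + (k ∸ toℕ j)) mod k

  -ₖ_ : Fin k → Fin k
  -ₖ j = (k ∸ toℕ j) mod k

  0ₖ : Fin k
  0ₖ = 0 mod k

  toℕ-mod : ∀ n → toℕ (n mod k) ≡ n % k
  toℕ-mod n = toℕ-fromℕ< (m%n<n n k)

  toℕ-0ₖ : toℕ 0ₖ ≡ 0
  toℕ-0ₖ = trans (toℕ-mod 0) (m<n⇒m%n≡m (ℕ.>-nonZero⁻¹ k))

  toℕ%k : ∀ (i : Fin k) → toℕ i % k ≡ toℕ i
  toℕ%k i = m<n⇒m%n≡m (toℕ<n i)

  +ₖ-identityʳ : ∀ i → i +ₖ 0ₖ ≡ i
  +ₖ-identityʳ i = toℕ-injective (begin
    toℕ (i +ₖ 0ₖ)        ≡⟨ toℕ-mod _ ⟩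
    (toℕ i + toℕ 0ₖ) % k ≡⟨ cong (λ z → (toℕ i + z) % k) toℕ-0ₖ ⟩
    (toℕ i + 0) % k      ≡⟨ cong (_% k) (ℕ.+-identityʳ (toℕ i)) ⟩
    toℕ i % k            ≡⟨ toℕ%k i ⟩
    toℕ i                ∎)
    where open ≡-Reasoning

  -ₖ-identityʳ : ∀ i → i -ₖ 0ₖ ≡ i
  -ₖ-identityʳ i = toℕ-injective (begin
    toℕ (i -ₖ 0ₖ)              ≡⟨ toℕ-mod _ ⟩
    (toℕ i + (k ∸ toℕ 0ₖ)) % k ≡⟨ cong (λ z → (toℕ i + (k ∸ z)) % k) toℕ-0ₖ ⟩
    (toℕ i + k) % k            ≡⟨ [m+n]%n≡m%n (toℕ i) k ⟩
    toℕ i % k                  ≡⟨ toℕ%k i ⟩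
    toℕ i                      ∎)
    where open ≡-Reasoning

  0ₖ-ₖ : ∀ j → 0ₖ -ₖ j ≡ -ₖ j
  0ₖ-ₖ j = toℕ-injective (begin
    toℕ (0ₖ -ₖ j)                ≡⟨ toℕ-mod _ ⟩
    (toℕ 0ₖ + (k ∸ toℕ j)) % k   ≡⟨ cong (λ z → (z + (k ∸ toℕ j)) % k) toℕ-0ₖ ⟩
    (k ∸ toℕ j) % k              ≡⟨ toℕ-mod _ ⟨
    toℕ (-ₖ j)                   ∎)
    where open ≡-Reasoning

  -ₖ≡+ₖ-ₖ : ∀ i j → i -ₖ j ≡ i +ₖ -ₖ j
  -ₖ≡+ₖ-ₖ i j = toℕ-injective (begin
    toℕ (i -ₖ j)                               ≡⟨ toℕ-mod _ ⟩
    (toℕ i + (k ∸ toℕ j)) % k                  ≡⟨ %-distribˡ-+ (toℕ i) (k ∸ toℕ j) k ⟩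
    (toℕ i % k + (k ∸ toℕ j) % k) % k          ≡⟨ cong (λ z → (toℕ i % k + z) % k) (m%n%n≡m%n (k ∸ toℕ j) k) ⟨
    (toℕ i % k + (k ∸ toℕ j) % k % k) % k      ≡⟨ %-distribˡ-+ (toℕ i) ((k ∸ toℕ j) % k) k ⟨
    (toℕ i + (k ∸ toℕ j) % k) % k              ≡⟨ cong (λ z → (toℕ i + z) % k) (toℕ-mod _) ⟨
    (toℕ i + toℕ (-ₖ j)) % k                   ≡⟨ toℕ-mod _ ⟨
    toℕ (i +ₖ -ₖ j)                            ∎)
    where open ≡-Reasoning

  -ₖ-involutive : ∀ j → -ₖ -ₖ j ≡ j
  -ₖ-involutive j = toℕ-injective (begin
    toℕ (-ₖ -ₖ j)              ≡⟨ toℕ-mod _ ⟩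
    (k ∸ toℕ (-ₖ j)) % k       ≡⟨ cong (λ z → (k ∸ z) % k) (toℕ-mod _) ⟩
    (k ∸ (k ∸ toℕ j) % k) % k  ≡⟨ k∸[k∸m]%k (toℕ j) (toℕ<n j) ⟩
    toℕ j                      ∎)
    where
    open ≡-Reasoning
    k∸[k∸m]%k : ∀ m → m < k → (k ∸ (k ∸ m) % k) % k ≡ m
    k∸[k∸m]%k zero    _   = begin
      (k ∸ k % k) % k ≡⟨ cong (λ z → (k ∸ z) % k) (n%n≡0 k) ⟩
      k % k           ≡⟨ n%n≡0 k ⟩
      0               ∎
    k∸[k∸m]%k (suc m) m<k = begin
      (k ∸ (k ∸ suc m) % k) % k ≡⟨ cong (λ z → (k ∸ z) % k) (m<n⇒m%n≡m (ℕ.∸-monoʳ-< (ℕ.s≤s ℕ.z≤n) (ℕ.<⇒≤ m<k))) ⟩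
      (k ∸ (k ∸ suc m)) % k     ≡⟨ cong (_% k) (ℕ.m∸[m∸n]≡n (ℕ.<⇒≤ m<k)) ⟩
      suc m % k                 ≡⟨ m<n⇒m%n≡m m<k ⟩
      suc m                     ∎

  +ₖ≡-ₖ-ₖ : ∀ i j → i +ₖ j ≡ i -ₖ -ₖ j
  +ₖ≡-ₖ-ₖ i j = sym (trans (-ₖ≡+ₖ-ₖ i (-ₖ j)) (cong (i +ₖ_) (-ₖ-involutive j)))

  flip₂ : Fin 2 → Fin 2
  flip₂ = add2 (suc zero)

  flip₂-involutive : Involutive _≡_ flip₂
  flip₂-involutive zero       = refl
  flip₂-involutive (suc zero) = refl

  flip₂-≢ : ∀ e → flip₂ e ≢ e
  flip₂-≢ zero       ()
  flip₂-≢ (suc zero) ()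

  D-elim : (P : D → Set) → (∀ i e → P (elt i e)) → ∀ g → P g
  D-elim P P-elt = combine-elim P (λ e i → P-elt i e)

  x-· : ∀ i m h → elt i zero · elt m h ≡ elt (i +ₖ m) h
  x-· i m h rewrite remQuot-combine {2} {k} h m | remQuot-combine {2} {k} zero i = refl

  xy-· : ∀ i m h → elt i (suc zero) · elt m h ≡ elt (i -ₖ m) (flip₂ h)
  xy-· i m h rewrite remQuot-combine {2} {k} h m | remQuot-combine {2} {k} (suc zero) i = refl

  elt-·y : ∀ i e → elt i e · y ≡ elt i (flip₂ e)
  elt-·y i zero       = trans (x-· i 0ₖ (suc zero)) (cong (λ j → elt j (suc zero)) (+ₖ-identityʳ i))
  elt-·y i (suc zero) = trans (xy-· i 0ₖ (suc zero)) (cong (λ j → elt j zero) (-ₖ-identityʳ i))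

  ·y-involutive : ∀ g → (g · y) · y ≡ g
  ·y-involutive = D-elim (λ g → (g · y) · y ≡ g) λ i e → begin
    (elt i e · y) · y       ≡⟨ cong (_· y) (elt-·y i e) ⟩
    elt i (flip₂ e) · y     ≡⟨ elt-·y i (flip₂ e) ⟩
    elt i (flip₂ (flip₂ e)) ≡⟨ cong (elt i) (flip₂-involutive e) ⟩
    elt i e                 ∎
    where open ≡-Reasoning

  ·y-injective : Injective _≡_ _≡_ (_· y)
  ·y-injective {g} {h} gy≡hy = trans (sym (·y-involutive g)) (trans (cong (_· y) gy≡hy) (·y-involutive h))

  ·y-≢ : ∀ g → g · y ≢ g
  ·y-≢ = D-elim (λ g → g · y ≢ g) λ i e gy≡g →
    flip₂-≢ e (combine-injectiveˡ (flip₂ e) i e i (trans (sym (elt-·y i e)) gy≡g))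

  yconj : D → D
  yconj g = (y · g) · y

  yconj-elt : ∀ m h → yconj (elt m h) ≡ elt (-ₖ m) h
  yconj-elt m h = begin
    (y · elt m h) · y                 ≡⟨ cong (_· y) (xy-· 0ₖ m h) ⟩
    elt (0ₖ -ₖ m) (flip₂ h) · y       ≡⟨ elt-·y (0ₖ -ₖ m) (flip₂ h) ⟩
    elt (0ₖ -ₖ m) (flip₂ (flip₂ h))   ≡⟨ cong₂ elt (0ₖ-ₖ m) (flip₂-involutive h) ⟩
    elt (-ₖ m) h                      ∎
    where open ≡-Reasoning

  yconj-involutive : Involutive _≡_ yconj
  yconj-involutive = D-elim (λ g → yconj (yconj g) ≡ g) λ m h → begin
    yconj (yconj (elt m h)) ≡⟨ cong yconj (yconj-elt m h) ⟩
    yconj (elt (-ₖ m) h)    ≡⟨ yconj-elt (-ₖ m) h ⟩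
    elt (-ₖ -ₖ m) h         ≡⟨ cong (λ j → elt j h) (-ₖ-involutive m) ⟩
    elt m h                 ∎
    where open ≡-Reasoning

  ·y-· : ∀ u g → (u · y) · g ≡ (u · yconj g) · y
  ·y-· u g = D-elim (λ u → (u · y) · g ≡ (u · yconj g) · y) (λ i e →
               D-elim (λ g → (elt i e · y) · g ≡ (elt i e · yconj g) · y) (elt-case i e) g) u
    where
    open ≡-Reasoning
    elt-case : ∀ i e m h → (elt i e · y) · elt m h ≡ (elt i e · yconj (elt m h)) · y
    elt-case i zero m h = begin
      (elt i zero · y) · elt m h          ≡⟨ cong (_· elt m h) (elt-·y i zero) ⟩
      elt i (suc zero) · elt m h          ≡⟨ xy-· i m h ⟩
      elt (i -ₖ m) (flip₂ h)              ≡⟨ cong (λ j → elt j (flip₂ h)) (-ₖ≡+ₖ-ₖ i m) ⟩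
      elt (i +ₖ -ₖ m) (flip₂ h)           ≡⟨ elt-·y (i +ₖ -ₖ m) h ⟨
      elt (i +ₖ -ₖ m) h · y               ≡⟨ cong (_· y) (x-· i (-ₖ m) h) ⟨
      (elt i zero · elt (-ₖ m) h) · y     ≡⟨ cong (λ g → (elt i zero · g) · y) (yconj-elt m h) ⟨
      (elt i zero · yconj (elt m h)) · y  ∎
    elt-case i (suc zero) m h = begin
      (elt i (suc zero) · y) · elt m h          ≡⟨ cong (_· elt m h) (elt-·y i (suc zero)) ⟩
      elt i zero · elt m h                      ≡⟨ x-· i m h ⟩
      elt (i +ₖ m) h                            ≡⟨ cong₂ elt (+ₖ≡-ₖ-ₖ i m) (sym (flip₂-involutive h)) ⟩
      elt (i -ₖ -ₖ m) (flip₂ (flip₂ h))         ≡⟨ elt-·y (i -ₖ -ₖ m) (flip₂ h) ⟨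
      elt (i -ₖ -ₖ m) (flip₂ h) · y             ≡⟨ cong (_· y) (xy-· i (-ₖ m) h) ⟨
      (elt i (suc zero) · elt (-ₖ m) h) · y     ≡⟨ cong (λ g → (elt i (suc zero) · g) · y) (yconj-elt m h) ⟨
      (elt i (suc zero) · yconj (elt m h)) · y  ∎

  part₁-x : ∀ w m → part₁ w (elt m zero) ≡ w (elt m zero)
  part₁-x w m rewrite remQuot-combine {2} {k} zero m = refl

  part₂-x : ∀ w m → part₂ w (elt m zero) ≡ w (elt m (suc zero))
  part₂-x w m rewrite remQuot-combine {2} {k} zero m = refl

  yInvariant⇒yconj-invariant : ∀ {w} → yInvariant w → ∀ g → w (yconj g) ≡ w g
  yInvariant⇒yconj-invariant {w} (inv₁ , inv₂) = D-elim (λ g → w (yconj g) ≡ w g) elt-case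
    where
    open ≡-Reasoning
    elt-case : ∀ m h → w (yconj (elt m h)) ≡ w (elt m h)
    elt-case m zero = begin
      w (yconj (elt m zero))        ≡⟨ cong w (yconj-elt m zero) ⟩
      w (elt (-ₖ m) zero)           ≡⟨ part₁-x w (-ₖ m) ⟨
      part₁ w (elt (-ₖ m) zero)     ≡⟨ cong (part₁ w) (yconj-elt m zero) ⟨
      part₁ w (yconj (elt m zero))  ≡⟨ inv₁ (elt m zero) ⟩
      part₁ w (elt m zero)          ≡⟨ part₁-x w m ⟩
      w (elt m zero)                ∎
    elt-case m (suc zero) = begin
      w (yconj (elt m (suc zero)))  ≡⟨ cong w (yconj-elt m (suc zero)) ⟩
      w (elt (-ₖ m) (suc zero))     ≡⟨ part₂-x w (-ₖ m) ⟨
      part₂ w (elt (-ₖ m) zero)     ≡⟨ cong (part₂ w) (yconj-elt m zero) ⟨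
      part₂ w (yconj (elt m zero))  ≡⟨ inv₂ (elt m zero) ⟩
      part₂ w (elt m zero)          ≡⟨ part₂-x w m ⟩
      w (elt m (suc zero))          ∎

  ρZ-·y : ∀ {w} → (∀ g → w (yconj g) ≡ w g) → Invariant (_· y) (ρZ w)
  ρZ-·y {w} w-inv u v = begin
    ∑ (λ g → w g ℤ.* δ ((u · y) · g) (v · y))         ≡⟨ ∑-cong (λ g → cong (λ z → w g ℤ.* δ z (v · y)) (·y-· u g)) ⟩
    ∑ (λ g → w g ℤ.* δ ((u · yconj g) · y) (v · y))   ≡⟨ ∑-cong (λ g → cong (w g ℤ.*_) (δ-injective ·y-injective (u · yconj g) v)) ⟩
    ∑ (λ g → w g ℤ.* δ (u · yconj g) v)               ≡⟨ ∑-cong (λ g → cong (ℤ._* δ (u · yconj g) v) (w-inv g)) ⟨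
    ∑ (λ g → w (yconj g) ℤ.* δ (u · yconj g) v)       ≡⟨ ∑-reindex-involution yconj-involutive (λ g → w g ℤ.* δ (u · g) v) ⟨
    ∑ (λ g → w g ℤ.* δ (u · g) v)                     ∎
    where open ≡-Reasoning

  pm-·y : ∀ {w} → yInvariant w → Invariant (_· y) (pm w)
  pm-·y w-inv u v = cong (λ z → + 2 ℤ.* z ℤ.- + 1) (ρZ-·y (yInvariant⇒yconj-invariant w-inv) u v)

  P-elt : ∀ i e j f → P (elt i e) (elt j f) ≡ (if ⌊ flip₂ e ≟ f ⌋ then δ i j else + 0)
  P-elt i e j f rewrite remQuot-combine {2} {k} f j | remQuot-combine {2} {k} e i with e | f
  ... | zero     | zero     = refl
  ... | zero     | suc zero = refl
  ... | suc zero | zero     = refl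
  ... | suc zero | suc zero = refl

  P≐ρy : P ≐ ρ y
  P≐ρy = D-elim _ λ i e → D-elim _ λ j f → begin
    P (elt i e) (elt j f)                  ≡⟨ P-elt i e j f ⟩
    (if ⌊ flip₂ e ≟ f ⌋ then δ i j else + 0) ≡⟨ δ-combine (flip₂ e) f i j ⟨
    δ (elt i (flip₂ e)) (elt j f)          ≡⟨ cong (λ g → δ g (elt j f)) (elt-·y i e) ⟨
    δ (elt i e · y) (elt j f)              ∎
    where open ≡-Reasoning

  top : Fin 4 → Fin N
  top a = a ↑ˡ 4 * (2 * k)

  block : Fin 4 → D → Fin N
  block r u = 4 ↑ʳ combine r u

  N-elim : (P : Fin N → Set) → (∀ a → P (top a)) → (∀ r u → P (block r u)) → ∀ i → P i
  N-elim = blocks-elim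

  module _ (a b c d : ZD) where

    Kimura-top-block : ∀ i s v → Kimura a b c d (top i) (block s v) ≡ Top i s
    Kimura-top-block i s v rewrite splitAt-↑ˡ 4 i (4 * (2 * k)) = cong (Top i ∘ proj₁) (remQuot-combine s v)

    Kimura-block-top : ∀ r u j → Kimura a b c d (block r u) (top j) ≡ Left r j
    Kimura-block-top r u j rewrite splitAt-↑ˡ 4 j (4 * (2 * k)) = cong ((λ r → Left r j) ∘ proj₁) (remQuot-combine r u)

    Kimura-block-block : ∀ r u s v → Kimura a b c d (block r u) (block s v) ≡ Core (pm a) (pm b) (pm c) (pm d) r s u v
    Kimura-block-block r u s v =
      cong₂ (λ (r , u) (s , v) → Core (pm a) (pm b) (pm c) (pm d) r s u v) (remQuot-combine r u) (remQuot-combine s v)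

  Q-top-top : ∀ i j → Q (top i) (top j) ≡ δ i j
  Q-top-top i j rewrite splitAt-↑ˡ 4 i (4 * (2 * k)) | splitAt-↑ˡ 4 j (4 * (2 * k)) = refl

  Q-top-block : ∀ i s v → Q (top i) (block s v) ≡ + 0
  Q-top-block i s v rewrite splitAt-↑ˡ 4 i (4 * (2 * k)) = refl

  Q-block-top : ∀ r u j → Q (block r u) (top j) ≡ + 0
  Q-block-top r u j rewrite splitAt-↑ˡ 4 j (4 * (2 * k)) = refl

  Q-block-block : ∀ r u s v → Q (block r u) (block s v) ≡ (if ⌊ r ≟ s ⌋ then P u v else + 0)
  Q-block-block r u s v =
    cong₂ (λ (r , u) (s , v) → if ⌊ r ≟ s ⌋ then P u v else + 0) (remQuot-combine r u) (remQuot-combine s v)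

  Core-invariant : ∀ {f A B C D′} → Invariant f A → Invariant f B → Invariant f C → Invariant f D′ →
                   ∀ r s → Invariant f (Core A B C D′ r s)
  Core-invariant iA iB iC iD zero                   zero                   = iA
  Core-invariant iA iB iC iD zero                   (suc zero)             = iB
  Core-invariant iA iB iC iD zero                   (suc (suc zero))       = iC
  Core-invariant iA iB iC iD zero                   (suc (suc (suc zero))) = iD
  Core-invariant iA iB iC iD (suc zero)             zero                   u v = cong -_ (iB u v)
  Core-invariant iA iB iC iD (suc zero)             (suc zero)             = iA
  Core-invariant iA iB iC iD (suc zero)             (suc (suc zero))       = iD
  Core-invariant iA iB iC iD (suc zero)             (suc (suc (suc zero))) u v = cong -_ (iC u v)
  Core-invariant iA iB iC iD (suc (suc zero))       zero                   u v = cong -_ (iC u v)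
  Core-invariant iA iB iC iD (suc (suc zero))       (suc zero)             u v = cong -_ (iD u v)
  Core-invariant iA iB iC iD (suc (suc zero))       (suc (suc zero))       = iA
  Core-invariant iA iB iC iD (suc (suc zero))       (suc (suc (suc zero))) = iB
  Core-invariant iA iB iC iD (suc (suc (suc zero))) zero                   = iD
  Core-invariant iA iB iC iD (suc (suc (suc zero))) (suc zero)             u v = cong -_ (iC u v)
  Core-invariant iA iB iC iD (suc (suc (suc zero))) (suc (suc zero))       = iB
  Core-invariant iA iB iC iD (suc (suc (suc zero))) (suc (suc (suc zero))) u v = cong -_ (iA u v)

  swapHalves : Fin N → Fin N
  swapHalves i with splitAt 4 i
  ... | inj₁ a = top a
  ... | inj₂ b = uncurry (λ r u → block r (u · y)) (remQuot {4} (2 * k) b)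

  swapHalves-top : ∀ a → swapHalves (top a) ≡ top a
  swapHalves-top a rewrite splitAt-↑ˡ 4 a (4 * (2 * k)) = refl

  swapHalves-block : ∀ r u → swapHalves (block r u) ≡ block r (u · y)
  swapHalves-block r u = cong (uncurry (λ r u → block r (u · y))) (remQuot-combine r u)

  swapHalves-involutive : Involutive _≡_ swapHalves
  swapHalves-involutive = N-elim (λ i → swapHalves (swapHalves i) ≡ i)
    (λ a → trans (cong swapHalves (swapHalves-top a)) (swapHalves-top a))
    (λ r u → trans (cong swapHalves (swapHalves-block r u))
               (trans (swapHalves-block r (u · y)) (cong (block r) (·y-involutive u))))

  swapHalves-block-≢ : ∀ r u → swapHalves (block r u) ≢ block r u
  swapHalves-block-≢ r u eq = ·y-≢ u (combine-injectiveʳ r (u · y) r u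
    (↑ʳ-injective 4 _ _ (trans (sym (swapHalves-block r u)) eq)))

  top≢block : ∀ a r u → top a ≢ block r u
  top≢block a r u eq with trans (sym (splitAt-↑ˡ 4 a (4 * (2 * k)))) (cong (splitAt 4) eq)
  ... | ()

  δ-block : ∀ r u s v → δ (block r u) (block s v) ≡ (if ⌊ r ≟ s ⌋ then δ u v else + 0)
  δ-block r u s v = trans (δ-injective (↑ʳ-injective 4 _ _) (combine r u) (combine s v)) (δ-combine r s u v)

  Q≐permMat : Q ≐ permMat swapHalves
  Q≐permMat = N-elim _ (λ a → N-elim _ (top-top a) (top-block a)) (λ r u → N-elim _ (block-top r u) (block-block r u))
    where
    open ≡-Reasoning
    top-top : ∀ a b → Q (top a) (top b) ≡ δ (swapHalves (top a)) (top b)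
    top-top a b = begin
      Q (top a) (top b)               ≡⟨ Q-top-top a b ⟩
      δ a b                           ≡⟨ δ-injective (↑ˡ-injective _ _ _) a b ⟨
      δ (top a) (top b)               ≡⟨ cong (λ i → δ i (top b)) (swapHalves-top a) ⟨
      δ (swapHalves (top a)) (top b)  ∎
    top-block : ∀ a s v → Q (top a) (block s v) ≡ δ (swapHalves (top a)) (block s v)
    top-block a s v = begin
      Q (top a) (block s v)               ≡⟨ Q-top-block a s v ⟩
      + 0                                 ≡⟨ δ-≢ (top≢block a s v) ⟨
      δ (top a) (block s v)               ≡⟨ cong (λ i → δ i (block s v)) (swapHalves-top a) ⟨
      δ (swapHalves (top a)) (block s v)  ∎
    block-top : ∀ r u b → Q (block r u) (top b) ≡ δ (swapHalves (block r u)) (top b)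
    block-top r u b = begin
      Q (block r u) (top b)               ≡⟨ Q-block-top r u b ⟩
      + 0                                 ≡⟨ δ-≢ (top≢block b r (u · y) ∘ sym) ⟨
      δ (block r (u · y)) (top b)         ≡⟨ cong (λ i → δ i (top b)) (swapHalves-block r u) ⟨
      δ (swapHalves (block r u)) (top b)  ∎
    block-block : ∀ r u s v → Q (block r u) (block s v) ≡ δ (swapHalves (block r u)) (block s v)
    block-block r u s v = begin
      Q (block r u) (block s v)                     ≡⟨ Q-block-block r u s v ⟩
      (if ⌊ r ≟ s ⌋ then P u v else + 0)            ≡⟨ cong (λ z → if ⌊ r ≟ s ⌋ then z else + 0) (P≐ρy u v) ⟩
      (if ⌊ r ≟ s ⌋ then δ (u · y) v else + 0)      ≡⟨ δ-block r (u · y) s v ⟨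
      δ (block r (u · y)) (block s v)               ≡⟨ cong (λ i → δ i (block s v)) (swapHalves-block r u) ⟨
      δ (swapHalves (block r u)) (block s v)        ∎

  Kimura-invariant : ∀ {a b c d} → yInvariant a → yInvariant b → yInvariant c → yInvariant d →
                     Invariant swapHalves (Kimura a b c d)
  Kimura-invariant {a} {b} {c} {d} ia ib ic id =
    N-elim _ (λ i → N-elim _ (top-top i) (top-block i)) (λ r u → N-elim _ (block-top r u) (block-block r u))
    where
    H : Mat N
    H = Kimura a b c d
    open ≡-Reasoning
    top-top : ∀ i j → H (swapHalves (top i)) (swapHalves (top j)) ≡ H (top i) (top j)
    top-top i j = cong₂ H (swapHalves-top i) (swapHalves-top j)
    top-block : ∀ i s v → H (swapHalves (top i)) (swapHalves (block s v)) ≡ H (top i) (block s v)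
    top-block i s v = begin
      H (swapHalves (top i)) (swapHalves (block s v)) ≡⟨ cong₂ H (swapHalves-top i) (swapHalves-block s v) ⟩
      H (top i) (block s (v · y))                     ≡⟨ Kimura-top-block a b c d i s (v · y) ⟩
      Top i s                                         ≡⟨ Kimura-top-block a b c d i s v ⟨
      H (top i) (block s v)                           ∎
    block-top : ∀ r u j → H (swapHalves (block r u)) (swapHalves (top j)) ≡ H (block r u) (top j)
    block-top r u j = begin
      H (swapHalves (block r u)) (swapHalves (top j)) ≡⟨ cong₂ H (swapHalves-block r u) (swapHalves-top j) ⟩
      H (block r (u · y)) (top j)                     ≡⟨ Kimura-block-top a b c d r (u · y) j ⟩
      Left r j                                        ≡⟨ Kimura-block-top a b c d r u j ⟨
      H (block r u) (top j)                           ∎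
    block-block : ∀ r u s v → H (swapHalves (block r u)) (swapHalves (block s v)) ≡ H (block r u) (block s v)
    block-block r u s v = begin
      H (swapHalves (block r u)) (swapHalves (block s v))  ≡⟨ cong₂ H (swapHalves-block r u) (swapHalves-block s v) ⟩
      H (block r (u · y)) (block s (v · y))                ≡⟨ Kimura-block-block a b c d r (u · y) s (v · y) ⟩
      Core (pm a) (pm b) (pm c) (pm d) r s (u · y) (v · y) ≡⟨ Core-invariant (pm-·y ia) (pm-·y ib) (pm-·y ic) (pm-·y id) r s u v ⟩
      Core (pm a) (pm b) (pm c) (pm d) r s u v             ≡⟨ Kimura-block-block a b c d r u s v ⟨
      H (block r u) (block s v)                            ∎

  Q-isSignedPerm : IsSignedPerm Q
  Q-isSignedPerm = permMat-isSignedPerm Q≐permMat swapHalves-involutive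

  Q-involutive : (Q ⊗ Q) ≐ Id
  Q-involutive = permMat-involutive Q≐permMat swapHalves-involutive

  Q≢Id : ¬ (Q ≐ Id)
  Q≢Id = permMat-≢Id Q≐permMat (block zero y) (swapHalves-block-≢ zero y)

  Q-fixes-Kimura : ∀ {a b c d} → yInvariant a → yInvariant b → yInvariant c → yInvariant d →
                   ((Q ⊗ Kimura a b c d) ⊗ Q ᵀ) ≐ Kimura a b c d
  Q-fixes-Kimura ia ib ic id = permMat-conjugate Q≐permMat (Kimura-invariant ia ib ic id)

proposition3p3 :
    (k : ℕ) .{{_ : NonZero k}} → 3 ≤ k → (∃ λ m → k ≡ 2 * m + 1) →
      let open Dihedral k in
      (a b c d : ZD) →
      ZeroOne a → ZeroOne b → ZeroOne c → ZeroOne d →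
      yInvariant a → yInvariant b → yInvariant c → yInvariant d →
      YieldsKimuraHadamard a b c d →
      IsAut (Kimura a b c d) Q Q × HasOrder2 Q Q
-- Oddness, 3 ≤ k, the 0/1 coefficients and the Hadamard property are not needed.
proposition3p3 k _ _ a b c d _ _ _ _ ia ib ic id _ =
    (Q-isSignedPerm k , Q-isSignedPerm k , Q-fixes-Kimura k ia ib ic id)
  , (Q-involutive k , Q-involutive k)
  , λ (Q≐Id , _) → Q≢Id k Q≐Id
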